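{- Let $G=(V,E)$ be a finite simple undirected chordal graph with $n$ vertices, and let $v_1,v_2,\dots,v_n$ be a perfect elimination ordering of its vertices. Run the following procedure. Form the $n\times n$ neighborhood matrix $M(G)$ with respect to the ordering $v_1,\dots,v_n$. While there exist indices $i<j$ and $k<l$ such that the $2\times 2$ submatrix of $M(G)$ on rows $i,j$ and columns $k,l$ equals $\begin{bmatrix}1&1\\1&0\end{bmatrix}$ (that is, $M_{ik}=M_{il}=M_{jk}=1$ and $M_{jl}=0$), add the edge $\{v_j,v_l\}$ to $G$ and update $M(G)$ accordingly (so that this $0$ entry becomes $1$). Then the procedure terminates, and the resulting graph $G'$ is strongly chordal, with $v_1,v_2,\dots,v_n$ a strong elimination ordering of $G'$.
   Context: For a vertex $v$, $N(v)$ is its set of neighbours and $N[v]=N(v)\cup\{v\}$ its closed neighbourhood. The neighborhood matrix $M(G)$ of a graph on vertices $v_1,\dots,v_n$ is the $n\times n$ $0/1$ matrix whose $(i,j)$ entry is $1$ if $v_i\in N[v_j]$ and $0$ otherwise. A graph is chordal if it has no chordless cycle of length at least $4$. A vertex $v$ is simplicial if $N(v)$ is a clique; an ordering $v_1,\dots,v_n$ is a perfect elimination ordering if each $v_i$ is simplicial in the subgraph induced by $\{v_i,\dots,v_n\}$. An ordering $v_1,\dots,v_n$ of $V$ is a strong elimination ordering if for all $i,j,k,l$ with $i<j$, $k<l$, $v_k,v_l\in N[v_i]$ and $v_k\in N[v_j]$, we have $v_l\in N[v_j]$. A graph is strongly chordal if it is chordal and every even cycle of length at least $6$ has a strong chord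 (an edge joining two vertices at odd distance greater than $1$ along the cycle); equivalently, if it admits a strong elimination ordering. -}

module Defs where

open import Data.Nat as ℕ using (ℕ; suc; _≤_; _%_; _⊓_; _∸_; ∣_-_∣)
open import Data.Fin as Fin using (Fin; toℕ; _≟_)
open import Data.Bool using (Bool; true; false; _∨_; _∧_)
open import Data.Product using (Σ; _×_; ∃)
open import Data.Sum using (_⊎_)
open import Relation.Nullary using (¬_)
open import Relation.Nullary.Decidable using (⌊_⌋)
open import Relation.Binary.PropositionalEquality using (_≡_)
open import Function.Definitions using (Injective)

-- A graph on the vertex set Fin n, given by a Boolean adjacency function.
-- Vertex i plays the role of v_{i+1} in the fixed ordering v_1,...,v_n.
Adj : ℕ → Set
Adj n = Fin n → Fin n → Bool

IsSimple : ∀ {n} → Adj n → Set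
IsSimple {n} A = (∀ x y → A x y ≡ A y x) × (∀ x → A x x ≡ false)

_∈N[_]in_ : ∀ {n} → Fin n → Fin n → Adj n → Set
a ∈N[ b ]in A = (a ≡ b) ⊎ (A a b ≡ true)

M : ∀ {n} → Adj n → Fin n → Fin n → Bool
M A i j = ⌊ i ≟ j ⌋ ∨ A i j

cycDist : (m : ℕ) → Fin m → Fin m → ℕ
cycDist m i j = ∣ toℕ i - toℕ j ∣ ⊓ (m ∸ ∣ toℕ i - toℕ j ∣)

IsCycle : ∀ {n} → Adj n → (m : ℕ) → (Fin m → Fin n) → Set
IsCycle A m c = (3 ≤ m) × Injective _≡_ _≡_ c
              × (∀ i j → cycDist m i j ≡ 1 → A (c i) (c j) ≡ true)

Chordless : ∀ {n} → Adj n → (m : ℕ) → (Fin m → Fin n) → Set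
Chordless A m c = ∀ i j → A (c i) (c j) ≡ true → cycDist m i j ≡ 1

Chordal : ∀ {n} → Adj n → Set
Chordal {n} A = ¬ (Σ ℕ λ m → Σ (Fin m → Fin n) λ c →
                    (4 ≤ m) × IsCycle A m c × Chordless A m c)

HasStrongChord : ∀ {n} → Adj n → (m : ℕ) → (Fin m → Fin n) → Set
HasStrongChord A m c = Σ (Fin m) λ i → Σ (Fin m) λ j →
  (2 ≤ cycDist m i j) × (cycDist m i j % 2 ≡ 1) × (A (c i) (c j) ≡ true)

StronglyChordal : ∀ {n} → Adj n → Set
StronglyChordal {n} A = Chordal A ×
  (∀ m (c : Fin m → Fin n) → 6 ≤ m → m % 2 ≡ 0 → IsCycle A m c →
     HasStrongChord A m c)

-- the identity ordering 0,1,...,n-1 is a perfect elimination ordering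
IsPEO : ∀ {n} → Adj n → Set
IsPEO A = ∀ i a b → i Fin.< a → i Fin.< b → ¬ (a ≡ b) →
  A i a ≡ true → A i b ≡ true → A a b ≡ true

IsSEO : ∀ {n} → Adj n → Set
IsSEO A = ∀ i j k l → i Fin.< j → k Fin.< l →
  k ∈N[ i ]in A → l ∈N[ i ]in A → k ∈N[ j ]in A → l ∈N[ j ]in A

addEdge : ∀ {n} → Adj n → Fin n → Fin n → Adj n
addEdge A j l x y = A x y ∨ (⌊ x ≟ j ⌋ ∧ ⌊ y ≟ l ⌋) ∨ (⌊ x ≟ l ⌋ ∧ ⌊ y ≟ j ⌋)

Step : ∀ {n} → Adj n → Adj n → Set
Step {n} A B = Σ (Fin n) λ i → Σ (Fin n) λ j → Σ (Fin n) λ k → Σ (Fin n) λ l →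
  (i Fin.< j) × (k Fin.< l) ×
  (M A i k ≡ true) × (M A i l ≡ true) × (M A j k ≡ true) × (M A j l ≡ false) ×
  (∀ x y → B x y ≡ addEdge A j l x y)

-- Each step adds an edge, so the procedure terminates. When no step applies, the
-- absence of the forbidden 2×2 submatrix is literally the strong elimination
-- condition for the identity ordering, and such an ordering alone forces strong
-- chordality. On a cycle … u₀ u₁ u₂ u₃ u₄ … with lowest vertex u₂, the condition
-- at u₂ makes u₁u₃ a chord; if moreover u₁ < u₃ it yields the chord u₀u₃, and
-- otherwise u₁u₄, each joining vertices at distance 3 along the cycle.

module Submission where

open import Defs
open import Data.Bool as Bool using (true; false; _∨_; _∧_)
open import Data.Bool.Properties using (∨-comm; ∧-comm; ∨-zeroʳ; ∨-conicalʳ; not-¬; ¬-not)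
open import Data.Empty using (⊥-elim)
open import Data.Fin as Fin using (Fin; toℕ; fromℕ<; _≟_; combine; remQuot)
open import Data.Fin.Properties using (toℕ-fromℕ<; toℕ-injective; toℕ<n; <-cmp; remQuot-combine)
open import Data.Fin.Subset using (Subset; _∈_; _⊂_)
open import Data.Fin.Subset.Induction using (⊃-wellFounded)
open import Data.List using (allFin)
open import Data.List.Extrema.Nat using (argmin; f[argmin]≤f[xs])
open import Data.List.Membership.Propositional.Properties using (∈-allFin)
import Data.List.Relation.Unary.All as All
open import Data.Nat using (ℕ; suc; _+_; _*_; _∸_; ∣_-_∣; _%_; _≤_; _<_; z≤n; s≤s; NonZero; >-nonZero)
open import Data.Nat.Properties
  using (≤-trans; ≤-reflexive; ≤-<-trans; _<?_; ≮⇒≥; ≤∧≢⇒<; +-assoc; m≤m+n; m∸n≤m; ∸-monoˡ-≤;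
         m+n∸m≡n; m+n∸n≡m; m∸n+n≡m; m∸[m∸n]≡n; m≤n⇒m⊓n≡m; m≥n⇒m⊓n≡n;
         ∣-∣-comm; ∣n-n∣≡0; ∣m-m+n∣≡n; m≤n⇒∣n-m∣≡n∸m)
open import Data.Nat.DivMod using (m%n<n; m<n⇒m%n≡m; [m+n]%n≡m%n; %-distribˡ-+; m%n%n≡m%n)
open import Data.Product using (_×_; _,_; proj₁; proj₂; uncurry)
open import Data.Sum using (_⊎_; inj₁; inj₂)
open import Data.Vec using (tabulate)
open import Data.Vec.Properties using (lookup∘tabulate; []=⇒lookup; lookup⇒[]=)
open import Function using (_∘_)
open import Function.Bundles using (Equivalence; _⇔_; mk⇔)
open import Function.Definitions using (Injective)
open import Induction.WellFounded using (Acc; module Subrelation)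
import Relation.Binary.Construct.On as On
open import Relation.Binary.Construct.Closure.ReflexiveTransitive using (Star; ε; _◅_)
open import Relation.Binary.Definitions using (tri<; tri≈; tri>)
open import Relation.Binary.PropositionalEquality
  using (_≡_; _≢_; refl; sym; trans; cong; cong₂; subst; ≢-sym; module ≡-Reasoning)
open import Relation.Nullary using (¬_; Dec; yes; no)
open import Relation.Nullary.Decidable using (⌊_⌋; _⊎-dec_; isYes≗does; dec-true; dec-false)

⌊⌋-true : ∀ {p} {P : Set p} (P? : Dec P) → P → ⌊ P? ⌋ ≡ true
⌊⌋-true P? p = trans (isYes≗does P?) (dec-true P? p)

⌊⌋-false : ∀ {p} {P : Set p} (P? : Dec P) → ¬ P → ⌊ P? ⌋ ≡ false
⌊⌋-false P? ¬p = trans (isYes≗does P?) (dec-false P? ¬p)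

IsSymmetric : ∀ {n} → Adj n → Set
IsSymmetric A = ∀ x y → A x y ≡ A y x

addEdge-symmetric : ∀ {n} {A : Adj n} j l → IsSymmetric A → IsSymmetric (addEdge A j l)
addEdge-symmetric {A = A} j l A-sym x y =
  cong₂ _∨_ (A-sym x y) (trans (∨-comm (⌊ x ≟ j ⌋ ∧ ⌊ y ≟ l ⌋) _)
                               (cong₂ _∨_ (∧-comm ⌊ x ≟ l ⌋ _) (∧-comm ⌊ x ≟ j ⌋ _)))

Step-symmetric : ∀ {n} {A B : Adj n} → Step A B → IsSymmetric A → IsSymmetric B
Step-symmetric (_ , j , _ , l , _ , _ , _ , _ , _ , _ , B≗) A-sym x y =
  trans (B≗ x y) (trans (addEdge-symmetric j l A-sym x y) (sym (B≗ y x)))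

Star-symmetric : ∀ {n} {A B : Adj n} → Star Step A B → IsSymmetric A → IsSymmetric B
Star-symmetric ε           = λ A-sym → A-sym
Star-symmetric (step ◅ st) = Star-symmetric st ∘ Step-symmetric step

∈N[]⇒M : ∀ {n} {A : Adj n} → IsSymmetric A → ∀ {x y} → x ∈N[ y ]in A → M A y x ≡ true
∈N[]⇒M {A = A} _     {x} (inj₁ refl) = cong (_∨ A x x) (⌊⌋-true (x ≟ x) refl)
∈N[]⇒M {A = A} A-sym {x} {y} (inj₂ Axy) = trans (cong (⌊ y ≟ x ⌋ ∨_) (trans (A-sym y x) Axy)) (∨-zeroʳ _)

∉N[]⇒M : ∀ {n} {A : Adj n} → IsSymmetric A → ∀ {x y} → ¬ x ∈N[ y ]in A → M A y x ≡ false
∉N[]⇒M {A = A} A-sym {x} {y} x∉ =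
  cong₂ _∨_ (⌊⌋-false (y ≟ x) (x∉ ∘ inj₁ ∘ sym)) (¬-not (x∉ ∘ inj₂ ∘ trans (A-sym x y)))

_∈N[_]in?_ : ∀ {n} (x y : Fin n) (A : Adj n) → Dec (x ∈N[ y ]in A)
x ∈N[ y ]in? A = x ≟ y ⊎-dec A x y Bool.≟ true

terminal⇒IsSEO : ∀ {n} {A : Adj n} → IsSymmetric A → (∀ B → ¬ Step A B) → IsSEO A
terminal⇒IsSEO {A = A} A-sym terminal i j k l i<j k<l k∈Ni l∈Ni k∈Nj with l ∈N[ j ]in? A
... | yes l∈Nj = l∈Nj
... | no  l∉Nj = ⊥-elim (terminal (addEdge A j l)
      (i , j , k , l , i<j , k<l , ∈N[]⇒M A-sym k∈Ni , ∈N[]⇒M A-sym l∈Ni , ∈N[]⇒M A-sym k∈Nj ,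
       ∉N[]⇒M A-sym l∉Nj , λ _ _ → refl))

edgeSet : ∀ {n} → Adj n → Subset (n * n)
edgeSet {n} A = tabulate (uncurry A ∘ remQuot n)

module _ {n} {A : Adj n} where

  ∈edgeSet⁺ : ∀ {t} → uncurry A (remQuot n t) ≡ true → t ∈ edgeSet A
  ∈edgeSet⁺ {t} e = lookup⇒[]= t (edgeSet A) (trans (lookup∘tabulate _ t) e)

  ∈edgeSet⁻ : ∀ {t} → t ∈ edgeSet A → uncurry A (remQuot n t) ≡ true
  ∈edgeSet⁻ {t} t∈ = trans (sym (lookup∘tabulate _ t)) ([]=⇒lookup t∈)

  combine∈edgeSet⇔ : ∀ {x y} → combine x y ∈ edgeSet A ⇔ A x y ≡ true
  combine∈edgeSet⇔ {x} {y} = mk⇔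
    (λ xy∈ → trans (sym (A[remQuot∘combine] x y)) (∈edgeSet⁻ xy∈))
    (λ Axy → ∈edgeSet⁺ (trans (A[remQuot∘combine] x y) Axy))
    where
    A[remQuot∘combine] : ∀ x y → uncurry A (remQuot n (combine x y)) ≡ A x y
    A[remQuot∘combine] x y = cong (uncurry A) (remQuot-combine x y)

addEdge-adds : ∀ {n} (A : Adj n) j l → addEdge A j l j l ≡ true
addEdge-adds A j l rewrite ⌊⌋-true (j ≟ j) refl | ⌊⌋-true (l ≟ l) refl = ∨-zeroʳ (A j l)

Step-monotone : ∀ {n} {A B : Adj n} → Step A B → ∀ x y → A x y ≡ true → B x y ≡ true
Step-monotone (_ , _ , _ , _ , _ , _ , _ , _ , _ , _ , B≗) x y Axy rewrite B≗ x y | Axy = refl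

Step-grows-edgeSet : ∀ {n} {A B : Adj n} → Step A B → edgeSet A ⊂ edgeSet B
Step-grows-edgeSet {A = A} {B} step@(_ , j , _ , l , _ , _ , _ , _ , _ , Mjl≡false , B≗) =
  (λ t∈ → ∈edgeSet⁺ {A = B} (Step-monotone step _ _ (∈edgeSet⁻ {A = A} t∈))) , combine j l ,
  Equivalence.from (combine∈edgeSet⇔ {A = B}) (trans (B≗ j l) (addEdge-adds A j l)) ,
  not-¬ (∨-conicalʳ _ _ Mjl≡false) ∘ Equivalence.to (combine∈edgeSet⇔ {A = A})

Step-acc : ∀ {n} (A : Adj n) → Acc (λ B A → Step A B) A
Step-acc A = Subrelation.accessible Step-grows-edgeSet (On.accessible edgeSet (⊃-wellFounded (edgeSet A)))

d≤m∸d : ∀ {m d} → d + d ≤ m → d ≤ m ∸ d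
d≤m∸d {m} {d} d+d≤m = ≤-trans (≤-reflexive (sym (m+n∸m≡n d d))) (∸-monoˡ-≤ d d+d≤m)

∣x-[x+d]%m∣≡d⊎m∸d : ∀ {m x d} .{{_ : NonZero m}} → x < m → d ≤ m →
  ∣ x - (x + d) % m ∣ ≡ d ⊎ ∣ x - (x + d) % m ∣ ≡ m ∸ d
∣x-[x+d]%m∣≡d⊎m∸d {m} {x} {d} x<m d≤m with x + d <? m
... | yes x+d<m = inj₁ (trans (cong (∣ x -_∣) (m<n⇒m%n≡m x+d<m)) (∣m-m+n∣≡n x d))
... | no  x+d≮m = inj₂ (begin
  ∣ x - (x + d) % m ∣       ≡⟨ cong (∣ x -_∣) [x+d]%m≡x∸[m∸d] ⟩
  ∣ x - x ∸ (m ∸ d) ∣       ≡⟨ m≤n⇒∣n-m∣≡n∸m (m∸n≤m x (m ∸ d)) ⟩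
  x ∸ (x ∸ (m ∸ d))         ≡⟨ m∸[m∸n]≡n m∸d≤x ⟩
  m ∸ d                     ∎)
  where
  open ≡-Reasoning
  m∸d≤x : m ∸ d ≤ x
  m∸d≤x = ≤-trans (∸-monoˡ-≤ d (≮⇒≥ x+d≮m)) (≤-reflexive (m+n∸n≡m x d))
  [x+d]%m≡x∸[m∸d] : (x + d) % m ≡ x ∸ (m ∸ d)
  [x+d]%m≡x∸[m∸d] = begin
    (x + d) % m                     ≡⟨ cong (λ t → (t + d) % m) (m∸n+n≡m m∸d≤x) ⟨
    (x ∸ (m ∸ d) + (m ∸ d) + d) % m ≡⟨ cong (_% m) (+-assoc (x ∸ (m ∸ d)) (m ∸ d) d) ⟩
    (x ∸ (m ∸ d) + (m ∸ d + d)) % m ≡⟨ cong (λ t → (x ∸ (m ∸ d) + t) % m) (m∸n+n≡m d≤m) ⟩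
    (x ∸ (m ∸ d) + m) % m           ≡⟨ [m+n]%n≡m%n (x ∸ (m ∸ d)) m ⟩
    (x ∸ (m ∸ d)) % m               ≡⟨ m<n⇒m%n≡m (≤-<-trans (m∸n≤m x (m ∸ d)) x<m) ⟩
    x ∸ (m ∸ d)                     ∎

module _ {m : ℕ} .{{_ : NonZero m}} where

  _⊕_ : Fin m → ℕ → Fin m
  p ⊕ d = fromℕ< (m%n<n (toℕ p + d) m)

  toℕ-⊕ : ∀ p d → toℕ (p ⊕ d) ≡ (toℕ p + d) % m
  toℕ-⊕ p d = toℕ-fromℕ< (m%n<n (toℕ p + d) m)

  ⊕-assoc : ∀ p a b → (p ⊕ a) ⊕ b ≡ p ⊕ (a + b)
  ⊕-assoc p a b = toℕ-injective (begin
    toℕ ((p ⊕ a) ⊕ b)                 ≡⟨ toℕ-⊕ (p ⊕ a) b ⟩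
    (toℕ (p ⊕ a) + b) % m             ≡⟨ cong (λ t → (t + b) % m) (toℕ-⊕ p a) ⟩
    ((toℕ p + a) % m + b) % m         ≡⟨ %-distribˡ-+ ((toℕ p + a) % m) b m ⟩
    ((toℕ p + a) % m % m + b % m) % m ≡⟨ cong (λ t → (t + b % m) % m) (m%n%n≡m%n (toℕ p + a) m) ⟩
    ((toℕ p + a) % m + b % m) % m     ≡⟨ %-distribˡ-+ (toℕ p + a) b m ⟨
    (toℕ p + a + b) % m               ≡⟨ cong (_% m) (+-assoc (toℕ p) a b) ⟩
    (toℕ p + (a + b)) % m             ≡⟨ toℕ-⊕ p (a + b) ⟨
    toℕ (p ⊕ (a + b))                 ∎)
    where open ≡-Reasoning

  ⊕-∸-cancel : ∀ p {d} → d ≤ m → (p ⊕ (m ∸ d)) ⊕ d ≡ p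
  ⊕-∸-cancel p {d} d≤m = trans (⊕-assoc p (m ∸ d) d) (toℕ-injective (begin
    toℕ (p ⊕ (m ∸ d + d))   ≡⟨ toℕ-⊕ p (m ∸ d + d) ⟩
    (toℕ p + (m ∸ d + d)) % m ≡⟨ cong (λ t → (toℕ p + t) % m) (m∸n+n≡m d≤m) ⟩
    (toℕ p + m) % m         ≡⟨ [m+n]%n≡m%n (toℕ p) m ⟩
    toℕ p % m               ≡⟨ m<n⇒m%n≡m (toℕ<n p) ⟩
    toℕ p                   ∎))
    where open ≡-Reasoning

  cycDist-⊕ : ∀ p d → d + d ≤ m → cycDist m p (p ⊕ d) ≡ d
  cycDist-⊕ p d d+d≤m rewrite toℕ-⊕ p d
    with ∣x-[x+d]%m∣≡d⊎m∸d (toℕ<n p) (≤-trans (m≤m+n d d) d+d≤m)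
  ... | inj₁ eq rewrite eq = m≤n⇒m⊓n≡m (d≤m∸d d+d≤m)
  ... | inj₂ eq rewrite eq | m∸[m∸n]≡n (≤-trans (m≤m+n d d) d+d≤m) = m≥n⇒m⊓n≡n (d≤m∸d d+d≤m)

cycDist-sym : ∀ m (i j : Fin m) → cycDist m i j ≡ cycDist m j i
cycDist-sym m i j rewrite ∣-∣-comm (toℕ i) (toℕ j) = refl

cycDist≡suc⇒≢ : ∀ m (i j : Fin m) {d} → cycDist m i j ≡ suc d → i ≢ j
cycDist≡suc⇒≢ m i .i eq refl rewrite ∣n-n∣≡0 (toℕ i) with eq
... | ()

module _ {n} {A : Adj n} (A-sym : IsSymmetric A) where

  adj⇒∈N[] : ∀ {x y} → A y x ≡ true → x ∈N[ y ]in A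
  adj⇒∈N[] {x} {y} Ayx = inj₂ (trans (A-sym x y) Ayx)

  ∈N[]⇒adj : ∀ {x y} → x ∈N[ y ]in A → x ≢ y → A y x ≡ true
  ∈N[]⇒adj (inj₁ x≡y) x≢y = ⊥-elim (x≢y x≡y)
  ∈N[]⇒adj {x} {y} (inj₂ Axy) _ = trans (A-sym y x) Axy

  IsSEO⇒IsPEO : IsSEO A → IsPEO A
  IsSEO⇒IsPEO seo i a b i<a i<b a≢b Aia Aib with <-cmp a b
  ... | tri< a<b _ _ = ∈N[]⇒adj (seo i a a b i<a a<b (adj⇒∈N[] Aia) (adj⇒∈N[] Aib) (inj₁ refl)) (≢-sym a≢b)
  ... | tri≈ _ a≡b _ = ⊥-elim (a≢b a≡b)
  ... | tri> _ _ b<a = trans (A-sym a b)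
        (∈N[]⇒adj (seo i b b a i<b b<a (adj⇒∈N[] Aib) (adj⇒∈N[] Aia) (inj₁ refl)) a≢b)

  IsSEO-adj : IsSEO A → ∀ {v w a b} → v Fin.< w → a Fin.< b →
    A v a ≡ true → A v b ≡ true → A w a ≡ true → b ≢ w → A w b ≡ true
  IsSEO-adj seo v<w a<b Ava Avb Awa =
    ∈N[]⇒adj (seo _ _ _ _ v<w a<b (adj⇒∈N[] Ava) (adj⇒∈N[] Avb) (adj⇒∈N[] Awa))

strongChord-at-distance-3 : ∀ {n} {A : Adj n} {m} {c : Fin m → Fin n} (i j : Fin m) →
  cycDist m i j ≡ 3 → A (c i) (c j) ≡ true → HasStrongChord A m c
strongChord-at-distance-3 i j d≡3 Acicj =
  i , j , subst (2 ≤_) (sym d≡3) (s≤s (s≤s z≤n)) , cong (_% 2) d≡3 , Acicj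

module SEOCycle {n} {A : Adj n} (A-sym : IsSymmetric A) (seo : IsSEO A)
                {m} (4≤m : 4 ≤ m) {c : Fin m → Fin n} (cycle : IsCycle A m c) where

  private instance
    m-nonZero : NonZero m
    m-nonZero = >-nonZero (≤-trans (s≤s z≤n) 4≤m)

  2≤m : 2 ≤ m
  2≤m = ≤-trans (s≤s (s≤s z≤n)) 4≤m

  c-inj : Injective _≡_ _≡_ c
  c-inj = proj₁ (proj₂ cycle)

  c-adj : ∀ i j → cycDist m i j ≡ 1 → A (c i) (c j) ≡ true
  c-adj = proj₂ (proj₂ cycle)

  lowest : Fin m
  lowest = argmin (toℕ ∘ c) (fromℕ< (≤-trans (s≤s z≤n) 4≤m)) (allFin m)

  lowest-minimal : ∀ i → i ≢ lowest → c lowest Fin.< c i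
  lowest-minimal i i≢lowest = ≤∧≢⇒<
    (All.lookup (f[argmin]≤f[xs] {f = toℕ ∘ c} _ (allFin m)) (∈-allFin i))
    (λ eq → i≢lowest (sym (c-inj (toℕ-injective eq))))

  -- The cycle read from two steps before its lowest vertex, which is thus v 2.
  pos : ℕ → Fin m
  pos a = (lowest ⊕ (m ∸ 2)) ⊕ a

  v : ℕ → Fin n
  v = c ∘ pos

  v₂-minimal : ∀ i → i ≢ pos 2 → v 2 Fin.< c i
  v₂-minimal i rewrite ⊕-∸-cancel lowest 2≤m = lowest-minimal i

  cycDist-pos : ∀ a d → d + d ≤ m → cycDist m (pos a) (pos (a + d)) ≡ d
  cycDist-pos a d d+d≤m = trans (cong (cycDist m (pos a)) (sym (⊕-assoc _ a d))) (cycDist-⊕ (pos a) d d+d≤m)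

  pos-distinct : ∀ a d → suc d + suc d ≤ m → pos a ≢ pos (a + suc d)
  pos-distinct a d d+d≤m = cycDist≡suc⇒≢ m _ _ (cycDist-pos a (suc d) d+d≤m)

  v-adj : ∀ a → A (v a) (v (a + 1)) ≡ true
  v-adj a = c-adj _ _ (cycDist-pos a 1 2≤m)

  v-adj⁻ : ∀ a → A (v (a + 1)) (v a) ≡ true
  v-adj⁻ a = trans (A-sym _ _) (v-adj a)

  v₁-adj-v₃ : A (v 1) (v 3) ≡ true
  v₁-adj-v₃ = IsSEO⇒IsPEO A-sym seo (v 2) (v 1) (v 3)
    (v₂-minimal (pos 1) (pos-distinct 1 0 2≤m)) (v₂-minimal (pos 3) (≢-sym (pos-distinct 2 0 2≤m)))
    (pos-distinct 1 1 4≤m ∘ c-inj) (v-adj⁻ 1) (v-adj 2)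

  not-chordless : ¬ Chordless A m c
  not-chordless chordless with trans (sym (cycDist-pos 1 2 4≤m)) (chordless (pos 1) (pos 3) v₁-adj-v₃)
  ... | ()

  strongChord : 6 ≤ m → HasStrongChord A m c
  strongChord 6≤m with <-cmp (v 1) (v 3)
  ... | tri< v₁<v₃ _ _ = strongChord-at-distance-3 {A = A} {c = c} (pos 0) (pos 3) (cycDist-pos 0 3 6≤m)
        (IsSEO-adj A-sym seo (v₂-minimal (pos 0) (pos-distinct 0 1 4≤m)) v₁<v₃
          (v-adj⁻ 1) (v-adj 2) (v-adj 0) (≢-sym (pos-distinct 0 2 6≤m) ∘ c-inj))
  ... | tri≈ _ v₁≡v₃ _ = ⊥-elim (pos-distinct 1 1 4≤m (c-inj v₁≡v₃))
  ... | tri> _ _ v₃<v₁ = strongChord-at-distance-3 {A = A} {c = c} (pos 4) (pos 1)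
        (trans (cycDist-sym m (pos 4) (pos 1)) (cycDist-pos 1 3 6≤m))
        (IsSEO-adj A-sym seo (v₂-minimal (pos 4) (≢-sym (pos-distinct 2 1 4≤m))) v₃<v₁
          (v-adj 2) (v-adj⁻ 1) (v-adj⁻ 3) (pos-distinct 1 2 6≤m ∘ c-inj))

module _ {n} {A : Adj n} (A-sym : IsSymmetric A) (seo : IsSEO A) where

  IsSEO⇒Chordal : Chordal A
  IsSEO⇒Chordal (m , c , 4≤m , cycle , chordless) = SEOCycle.not-chordless A-sym seo 4≤m cycle chordless

  IsSEO⇒StronglyChordal : StronglyChordal A
  IsSEO⇒StronglyChordal = IsSEO⇒Chordal , λ m c 6≤m _ cycle →
    SEOCycle.strongChord A-sym seo (≤-trans (s≤s (s≤s (s≤s (s≤s z≤n)))) 6≤m) cycle 6≤m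

mainTheorem1 : (n : ℕ) (G : Adj n) → IsSimple G → Chordal G → IsPEO G →
    Acc (λ B A → Step A B) G ×
    (∀ G′ → Star Step G G′ → (∀ G″ → ¬ Step G′ G″) →
       StronglyChordal G′ × IsSEO G′)
mainTheorem1 n G (G-sym , _) _ _ = Step-acc G , λ G′ G↝G′ terminal →
  let G′-sym = Star-symmetric G↝G′ G-sym
      G′-seo = terminal⇒IsSEO G′-sym terminal
  in IsSEO⇒StronglyChordal G′-sym G′-seo , G′-seo
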